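{- Let $p,n_d,k$ be positive integers with $n_d\ge4p-2$ and $k>1$, and let $V_d=\{v_1,\dots,v_{n_d}\}$. Let $U$ be the number of subsets $S\subseteq V_d$ with $|S|=k$ such that, with $m:=\min\{j:v_j\in S\}$ and $M:=\max\{j:v_j\in S\}$, we have $v_l\in S$ for all $l\in[m+p,M-p]$. Then: - if $k\in[2p,n_d-2p+2]$, then $U=(n_d-k-p+2)4^{p-1}$; - if $k<2p$, then $U\le (n_d-k-p+2)4^{p-1}$; - if $k>n_d-2p+2$, then $U\le p\cdot4^{p-1}$.
   Context: $[a,b]$ denotes the integer interval $\{a,a+1,\dots,b\}$, empty if $a>b$. -}

module Defs where

open import Data.Nat using (ℕ; zero; suc; _+_; _∸_; _≤_; _≤?_)
open import Data.Nat.Properties using (_≟_)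
open import Data.Bool using (Bool; true; false; if_then_else_)
open import Data.Maybe using (Maybe; just; nothing; fromMaybe)
open import Data.List using (List; []; _∷_; _++_; map; filter; length)
open import Data.Vec using (Vec; []; _∷_)
open import Data.Fin using (Fin; toℕ)
open import Data.Fin.Subset using (Subset; _∈_; ∣_∣)
open import Data.Fin.Subset.Properties using (_∈?_)
open import Data.Fin.Properties using (all?)
open import Data.Product using (_×_)
open import Relation.Nullary using (Dec)
open import Relation.Nullary.Decidable using (_×-dec_; _→-dec_)
open import Relation.Binary.PropositionalEquality using (_≡_)

-- All subsets of Fin n (the ground set V_d = {v_1,…,v_n} with v_{j+1} ↔ j : Fin n).
allSubsets : (n : ℕ) → List (Subset n)
allSubsets zero = [] ∷ []
allSubsets (suc n) = map (true ∷_) (allSubsets n) ++ map (false ∷_) (allSubsets n)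

firstIn : {n : ℕ} → Subset n → Maybe ℕ
firstIn [] = nothing
firstIn (true ∷ s) = just 0
firstIn (false ∷ s) with firstIn s
... | just j = just (suc j)
... | nothing = nothing

lastIn : {n : ℕ} → Subset n → Maybe ℕ
lastIn [] = nothing
lastIn (b ∷ s) with lastIn s
... | just j = just (suc j)
... | nothing = if b then just 0 else nothing

-- m := min{j : v_j ∈ S}, M := max{j : v_j ∈ S} (0-based; S is nonempty whenever used)
minIdx : {n : ℕ} → Subset n → ℕ
minIdx s = fromMaybe 0 (firstIn s)

maxIdx : {n : ℕ} → Subset n → ℕ
maxIdx s = fromMaybe 0 (lastIn s)

GapCond : (p : ℕ) {n : ℕ} → Subset n → Set
GapCond p {n} S = (l : Fin n) → (minIdx S + p ≤ toℕ l × toℕ l ≤ maxIdx S ∸ p) → l ∈ S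

gapCond? : (p : ℕ) {n : ℕ} (S : Subset n) → Dec (GapCond p S)
gapCond? p S = all? (λ l → ((minIdx S + p ≤? toℕ l) ×-dec (toℕ l ≤? maxIdx S ∸ p)) →-dec (l ∈? S))

Good : (p n k : ℕ) → Subset n → Set
Good p n k S = (∣ S ∣ ≡ k) × GapCond p S

good? : (p n k : ℕ) (S : Subset n) → Dec (Good p n k S)
good? p n k S = (∣ S ∣ ≟ k) ×-dec gapCond? p S

U : (p n k : ℕ) → ℕ
U p n k = length (filter (good? p n k) (allSubsets n))

-- The gap condition says that a position belongs to S as soon as S has elements at distance at
-- least p on both sides of it. Reading S from the left and writing q = p − 1: the q positions
-- after the least element are free, after them every position is an element up to the first
-- hole l, and all later elements lie below l + p. This finite-state description yields
-- recursions, in the numbers h of holes and k of elements, for the number of admissible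
-- suffixes; comparing them with the partial binomial sums choose≤ gives
-- U ≤ Σ_{d ≤ h} choose≤ (2q) d, with equality once k > 2q. As choose≤ m d = 2^m for d ≥ m and
-- 2 Σ_{d < m} choose≤ m d = m 2^m, the sum is (h + 1 − q) 4^q for h ≥ 2q and at most q 4^q
-- otherwise; with h = n − k these are the three cases.

module Submission where

open import Defs
open import Data.Bool using (Bool; true; false)
open import Data.Empty using (⊥)
open import Data.Fin using (Fin; zero; suc; toℕ)
open import Data.Fin.Subset using (Subset; _∈_; ∣_∣; Empty)
open import Data.Fin.Subset.Properties using (∣p∣≤n; drop-there)
open import Data.List using (List; []; _∷_; _++_; map; filter; length)
open import Data.List.Properties using (filter-++; length-++)
open import Data.Maybe using (Maybe; just; nothing)
open import Data.Nat
  using (ℕ; zero; suc; _+_; _*_; _∸_; _^_; _≤_; _<_; _>_; _≥_; z≤n; s≤s; s≤s⁻¹)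
open import Data.Nat.Properties
open import Algebra.Properties.CommutativeSemigroup +-commutativeSemigroup
  using (x∙yz≈y∙xz; interchange)
open import Data.Nat.Tactic.RingSolver using (solve-∀)
open import Data.Product using (Σ-syntax; _×_; _,_; proj₁; proj₂)
open import Data.Product.Function.NonDependent.Propositional using (_×-⇔_)
open import Data.Vec using ([]; _∷_; here; there)
open import Function using (_∘_; id)
open import Function.Construct.Composition using (_⇔-∘_)
open import Function.Bundles using (_⇔_; mk⇔; Equivalence)
open import Level using (0ℓ)
open import Relation.Nullary using (¬_; contradiction; yes; no; does)
open import Relation.Unary using (Pred; Decidable)
open import Relation.Binary.PropositionalEquality
  using (_≡_; _≢_; refl; sym; trans; cong; cong₂; subst; module ≡-Reasoning)

open Equivalence using (to; from)

module _ {A : Set} {P : Pred A 0ℓ} (P? : Decidable P) where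

  length-filter-none : (∀ x → ¬ P x) → ∀ xs → length (filter P? xs) ≡ 0
  length-filter-none ¬P [] = refl
  length-filter-none ¬P (x ∷ xs) with P? x
  ... | yes Px = contradiction Px (¬P x)
  ... | no _ = length-filter-none ¬P xs

  length-filter-map : {B : Set} (f : B → A) (xs : List B) →
                      length (filter P? (map f xs)) ≡ length (filter (P? ∘ f) xs)
  length-filter-map f [] = refl
  length-filter-map f (x ∷ xs) with does (P? (f x))
  ... | true = cong suc (length-filter-map f xs)
  ... | false = length-filter-map f xs

length-filter-allSubsets : ∀ {n} {P : Pred (Subset (suc n)) 0ℓ} (P? : Decidable P) →
  length (filter P? (allSubsets (suc n)))
    ≡ length (filter (λ s → P? (true ∷ s)) (allSubsets n))
      + length (filter (λ s → P? (false ∷ s)) (allSubsets n))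
length-filter-allSubsets {n} P? = begin
  length (filter P? (ins ++ outs))                 ≡⟨ cong length (filter-++ P? ins outs) ⟩
  length (filter P? ins ++ filter P? outs)         ≡⟨ length-++ (filter P? ins) ⟩
  length (filter P? ins) + length (filter P? outs) ≡⟨ cong₂ _+_ (length-filter-map P? (true ∷_) (allSubsets n))
                                                                (length-filter-map P? (false ∷_) (allSubsets n)) ⟩
  length (filter (λ s → P? (true ∷ s)) (allSubsets n))
    + length (filter (λ s → P? (false ∷ s)) (allSubsets n)) ∎
  where
  open ≡-Reasoning
  ins outs : List (Subset (suc n))
  ins = map (true ∷_) (allSubsets n)
  outs = map (false ∷_) (allSubsets n)

module _ {n : ℕ} where

  Has : (ℕ → Set) → Subset n → Set
  Has P s = Σ[ i ∈ Fin n ] i ∈ s × P (toℕ i)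

  Interior : ℕ → Subset n → Set
  Interior p s = ∀ l → Has (λ i → i + p ≤ toℕ l) s → Has (λ j → toℕ l + p ≤ j) s → l ∈ s

data Extremum {n : ℕ} (_≺_ : ℕ → ℕ → Set) (s : Subset n) : Maybe ℕ → Set where
  none : Empty s → Extremum _≺_ s nothing
  some : (i : Fin n) → i ∈ s → (∀ {j} → j ∈ s → toℕ i ≺ toℕ j) →
         Extremum _≺_ s (just (toℕ i))

firstIn-extremum : ∀ {n} (s : Subset n) → Extremum _≤_ s (firstIn s)
firstIn-extremum [] = none λ ()
firstIn-extremum (true ∷ s) = some zero here (λ _ → z≤n)
firstIn-extremum (false ∷ s) with firstIn s | firstIn-extremum s
... | just _ | some i i∈s least = some (suc i) (there i∈s) λ { (there j∈s) → s≤s (least j∈s) }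
... | nothing | none empty = none λ { (suc j , there j∈s) → empty (j , j∈s) }

lastIn-extremum : ∀ {n} (s : Subset n) → Extremum _≥_ s (lastIn s)
lastIn-extremum [] = none λ ()
lastIn-extremum (b ∷ s) with lastIn s | lastIn-extremum s
... | just _ | some i i∈s greatest =
  some (suc i) (there i∈s) λ { here → z≤n ; (there j∈s) → s≤s (greatest j∈s) }
lastIn-extremum (true ∷ s) | nothing | none empty =
  some zero here λ { here → z≤n ; (there j∈s) → contradiction (_ , j∈s) empty }
lastIn-extremum (false ∷ s) | nothing | none empty =
  none λ { (suc j , there j∈s) → empty (j , j∈s) }

m≤n∸o⇒m+o≤n : ∀ {m} n o → 1 ≤ m → m ≤ n ∸ o → m + o ≤ n
m≤n∸o⇒m+o≤n n zero _ le = subst (_≤ n) (sym (+-identityʳ _)) le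
m≤n∸o⇒m+o≤n zero (suc o) 1≤m le = contradiction (≤-trans 1≤m le) λ ()
m≤n∸o⇒m+o≤n (suc n) (suc o) 1≤m le =
  subst (_≤ suc n) (sym (+-suc _ o)) (s≤s (m≤n∸o⇒m+o≤n n o 1≤m le))

module _ {n : ℕ} {s : Subset n} where

  Has-below⇔minIdx : ∀ {p l i} → i ∈ s → Has (λ j → j + p ≤ l) s ⇔ minIdx s + p ≤ l
  Has-below⇔minIdx {p} i∈s with firstIn s | firstIn-extremum s
  ... | nothing | none empty = contradiction (_ , i∈s) empty
  ... | just _ | some m m∈s least =
    mk⇔ (λ (j , j∈s , le) → ≤-trans (+-monoˡ-≤ p (least j∈s)) le) (λ le → m , m∈s , le)

  Has-above⇔maxIdx : ∀ {t} → 1 ≤ t → Has (t ≤_) s ⇔ t ≤ maxIdx s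
  Has-above⇔maxIdx 1≤t with lastIn s | lastIn-extremum s
  ... | nothing | none empty =
    mk⇔ (λ (j , j∈s , _) → contradiction (j , j∈s) empty)
        (λ t≤0 → contradiction (≤-trans 1≤t t≤0) λ ())
  ... | just _ | some M M∈s greatest =
    mk⇔ (λ (j , j∈s , le) → ≤-trans le (greatest j∈s)) (λ le → M , M∈s , le)

  GapCond⇔Interior : ∀ {p} → 1 ≤ p → GapCond p s ⇔ Interior p s
  GapCond⇔Interior {p} 1≤p = mk⇔ toInterior toGapCond
    where
    1≤l+p : ∀ l → 1 ≤ l + p
    1≤l+p l = ≤-trans 1≤p (m≤n+m p l)

    toInterior : GapCond p s → Interior p s
    toInterior gap l below@(_ , i∈s , _) above =
      gap l ( to (Has-below⇔minIdx i∈s) below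
            , m+n≤o⇒m≤o∸n (toℕ l) (to (Has-above⇔maxIdx (1≤l+p (toℕ l))) above))

    toGapCond : Interior p s → GapCond p s
    toGapCond interior l (m+p≤l , l≤M∸p) = interior l (from (Has-below⇔minIdx j∈s) m+p≤l) above
      where
      1≤l : 1 ≤ toℕ l
      1≤l = ≤-trans 1≤p (≤-trans (m≤n+m p (minIdx s)) m+p≤l)
      above : Has (toℕ l + p ≤_) s
      above = from (Has-above⇔maxIdx (1≤l+p (toℕ l))) (m≤n∸o⇒m+o≤n (maxIdx s) p 1≤l l≤M∸p)
      j∈s : proj₁ above ∈ s
      j∈s = proj₁ (proj₂ above)

data State : Set where
  start  : ℕ → State
  filled : ℕ → ℕ → State
  tail   : ℕ → State

step : Bool → State → Maybe State
step _     (filled (suc c) w) = just (filled c w)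
step _     (tail (suc j))     = just (tail j)
step true  (start q)          = just (filled q q)
step false (start q)          = just (start q)
step true  (filled zero w)    = just (filled zero w)
step false (filled zero w)    = just (tail w)
step true  (tail zero)        = nothing
step false (tail zero)        = just (tail zero)

module _ {n : ℕ} where

  Filled : ℕ → ℕ → Subset n → Set
  Filled c w s = ∀ l → c ≤ toℕ l → Has (toℕ l + suc w ≤_) s → l ∈ s

  Below : ℕ → Subset n → Set
  Below j s = ∀ i → i ∈ s → toℕ i < j

  Admits : Maybe State → Subset n → Set
  Admits nothing             s = ⊥
  Admits (just (start q))    s = Interior (suc q) s
  Admits (just (filled c w)) s = Filled c w s
  Admits (just (tail j))     s = Below j s

Admits-[] : ∀ st → Admits (just st) []
Admits-[] (start q) ()
Admits-[] (filled c w) ()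
Admits-[] (tail j) _ ()

module _ {n : ℕ} {b : Bool} {s : Subset n} where

  Has-above-∷ : ∀ {t} → Has (suc t ≤_) (b ∷ s) ⇔ Has (t ≤_) s
  Has-above-∷ = mk⇔ (λ { (suc j , there j∈s , s≤s le) → j , j∈s , le })
                    (λ (j , j∈s , le) → suc j , there j∈s , s≤s le)

  Filled-suc-∷ : ∀ {c w} → Filled (suc c) w (b ∷ s) ⇔ Filled c w s
  Filled-suc-∷ = mk⇔
    (λ f l c≤l above → drop-there (f (suc l) (s≤s c≤l) (from Has-above-∷ above)))
    (λ { f zero () _ ; f (suc l) (s≤s c≤l) above → there (f l c≤l (to Has-above-∷ above)) })

  Below-suc-∷ : ∀ {j} → Below (suc j) (b ∷ s) ⇔ Below j s
  Below-suc-∷ = mk⇔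
    (λ below i i∈s → s≤s⁻¹ (below (suc i) (there i∈s)))
    (λ { below zero _ → s≤s z≤n ; below (suc i) (there i∈s) → s≤s (below i i∈s) })

module _ {n : ℕ} {s : Subset n} where

  Has-below-false-∷ : ∀ {p l} → Has (λ i → i + p ≤ suc l) (false ∷ s) ⇔ Has (λ i → i + p ≤ l) s
  Has-below-false-∷ = mk⇔ (λ { (suc i , there i∈s , s≤s le) → i , i∈s , le })
                          (λ (i , i∈s , le) → suc i , there i∈s , s≤s le)

  Interior-true-∷ : ∀ {q} → Interior (suc q) (true ∷ s) ⇔ Filled q q s
  Interior-true-∷ {q} = mk⇔
    (λ int l q≤l above → drop-there (int (suc l) (zero , here , s≤s q≤l) (from Has-above-∷ above)))
    λ { _ zero _ _ → here
      ; f (suc l) (i , _ , le) above →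
          there (f l (s≤s⁻¹ (≤-trans (m≤n+m (suc q) (toℕ i)) le)) (to Has-above-∷ above)) }

  Interior-false-∷ : ∀ {q} → Interior (suc q) (false ∷ s) ⇔ Interior (suc q) s
  Interior-false-∷ = mk⇔
    (λ int l below above →
       drop-there (int (suc l) (from Has-below-false-∷ below) (from Has-above-∷ above)))
    λ { _ zero (suc _ , there _ , ()) _
      ; int (suc l) below above → there (int l (to Has-below-false-∷ below) (to Has-above-∷ above)) }

  Filled-zero-true-∷ : ∀ {w} → Filled 0 w (true ∷ s) ⇔ Filled 0 w s
  Filled-zero-true-∷ = mk⇔
    (λ f l _ above → drop-there (f (suc l) z≤n (from Has-above-∷ above)))
    λ { _ zero _ _ → here ; f (suc l) _ above → there (f l z≤n (to Has-above-∷ above)) }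

  Filled-zero-false-∷ : ∀ {w} → Filled 0 w (false ∷ s) ⇔ Below w s
  Filled-zero-false-∷ {w} = mk⇔ toBelow fromBelow
    where
    toBelow : Filled 0 w (false ∷ s) → Below w s
    toBelow f i i∈s with toℕ i <? w
    ... | yes i<w = i<w
    ... | no i≮w with () ← f zero z≤n (suc i , there i∈s , s≤s (≮⇒≥ i≮w))

    fromBelow : Below w s → Filled 0 w (false ∷ s)
    fromBelow below l _ (suc i , there i∈s , l+w<i) =
      contradiction (below i i∈s) (≤⇒≯ (s≤s⁻¹ (≤-trans (m≤n+m (suc w) (toℕ l)) l+w<i)))

  Below-zero-false-∷ : Below 0 (false ∷ s) ⇔ Below 0 s
  Below-zero-false-∷ = mk⇔ (λ below i i∈s → contradiction (below (suc i) (there i∈s)) λ ())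
                             (λ { below (suc i) (there i∈s) → contradiction (below i i∈s) λ () })

Admits-step : ∀ st b {n} {s : Subset n} → Admits (just st) (b ∷ s) ⇔ Admits (step b st) s
Admits-step (start q) true = Interior-true-∷
Admits-step (start q) false = Interior-false-∷
Admits-step (filled (suc c) w) b = Filled-suc-∷
Admits-step (filled zero w) true = Filled-zero-true-∷
Admits-step (filled zero w) false = Filled-zero-false-∷
Admits-step (tail (suc j)) b = Below-suc-∷
Admits-step (tail zero) true = mk⇔ (λ below → contradiction (below zero here) λ ()) λ ()
Admits-step (tail zero) false = Below-zero-false-∷

-- accepted m h k counts the suffixes with h holes and k elements that m admits.
accepted : Maybe State → ℕ → ℕ → ℕ
accepted nothing   _       _       = 0
accepted (just st) zero    zero    = 1
accepted (just st) zero    (suc k) = accepted (step true st) zero k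
accepted (just st) (suc h) zero    = accepted (step false st) h zero
accepted (just st) (suc h) (suc k) = accepted (step true st) (suc h) k + accepted (step false st) h (suc k)

n<k⇒∣p∣≢k : ∀ {n k} (s : Subset n) → n < k → ∣ s ∣ ≢ k
n<k⇒∣p∣≢k {n} s n<k ∣s∣≡k = <⇒≱ n<k (subst (_≤ n) ∣s∣≡k (∣p∣≤n s))

module _ {n : ℕ} where

  Accepts : Maybe State → ℕ → Subset n → Set
  Accepts m k s = ∣ s ∣ ≡ k × Admits m s

module _ {n : ℕ} {s : Subset n} where

  Accepts-true-∷ : ∀ st {k} → Accepts (just st) (suc k) (true ∷ s) ⇔ Accepts (step true st) k s
  Accepts-true-∷ st = mk⇔ suc-injective (cong suc) ×-⇔ Admits-step st true

  Accepts-false-∷ : ∀ st {k} → Accepts (just st) k (false ∷ s) ⇔ Accepts (step false st) k s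
  Accepts-false-∷ st = mk⇔ id id ×-⇔ Admits-step st false

  Accepts-zero-true : ∀ {m} → ¬ Accepts m 0 (true ∷ s)
  Accepts-zero-true ()

-- Stated for every P equivalent to Accepts m k, so that recursive calls can take P ∘ (b ∷_).
length-filter-accepted : ∀ m h k {n} → h + k ≡ n → {P : Pred (Subset n) 0ℓ} (P? : Decidable P) →
  (∀ s → P s ⇔ Accepts m k s) → length (filter P? (allSubsets n)) ≡ accepted m h k
length-filter-accepted nothing _ _ _ P? P⇔ =
  length-filter-none P? (λ s → proj₂ ∘ to (P⇔ s)) (allSubsets _)
length-filter-accepted (just st) zero zero {zero} refl P? P⇔ with P? []
... | yes _ = refl
... | no ¬P[] = contradiction (from (P⇔ []) (refl , Admits-[] st)) ¬P[]
length-filter-accepted (just st) zero (suc k) {suc n} eq P? P⇔ =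
  trans (length-filter-allSubsets P?) (trans (cong₂ _+_
    (length-filter-accepted (step true st) zero k (suc-injective eq) _
      λ s → Accepts-true-∷ st ⇔-∘ P⇔ (true ∷ s))
    (length-filter-none _
      (λ s → n<k⇒∣p∣≢k s (≤-reflexive (sym eq)) ∘ proj₁ ∘ to (Accepts-false-∷ st ⇔-∘ P⇔ (false ∷ s)))
      (allSubsets n)))
    (+-identityʳ _))
length-filter-accepted (just st) (suc h) zero {suc n} eq P? P⇔ =
  trans (length-filter-allSubsets P?) (cong₂ _+_
    (length-filter-none _ (λ s → Accepts-zero-true ∘ to (P⇔ (true ∷ s))) (allSubsets n))
    (length-filter-accepted (step false st) h zero (suc-injective eq) _
      λ s → Accepts-false-∷ st ⇔-∘ P⇔ (false ∷ s)))
length-filter-accepted (just st) (suc h) (suc k) {suc n} eq P? P⇔ =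
  trans (length-filter-allSubsets P?) (cong₂ _+_
    (length-filter-accepted (step true st) (suc h) k (suc-injective (trans (sym (+-suc (suc h) k)) eq)) _
      λ s → Accepts-true-∷ st ⇔-∘ P⇔ (true ∷ s))
    (length-filter-accepted (step false st) h (suc k) (suc-injective eq) _
      λ s → Accepts-false-∷ st ⇔-∘ P⇔ (false ∷ s)))

U≡accepted : ∀ q h k {n} → h + k ≡ n → U (suc q) n k ≡ accepted (just (start q)) h k
U≡accepted q h k h+k≡n = length-filter-accepted (just (start q)) h k h+k≡n (good? (suc q) _ k)
  λ s → mk⇔ id id ×-⇔ GapCond⇔Interior (s≤s z≤n)

U-oversized : ∀ p {n k} → n < k → U p n k ≡ 0
U-oversized p {n} {k} n<k =
  length-filter-none (good? p n k) (λ s → n<k⇒∣p∣≢k s n<k ∘ proj₁) (allSubsets n)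

infix 4 _≤_≡if_
_≤_≡if_ : ℕ → ℕ → Set → Set
x ≤ y ≡if E = x ≤ y × (E → x ≡ y)

≡if-refl : ∀ {x y E} → x ≡ y → x ≤ y ≡if E
≡if-refl x≡y = ≤-reflexive x≡y , λ _ → x≡y

≡if-+ : ∀ {x y x′ y′ E} → x ≤ y ≡if E → x′ ≤ y′ ≡if E → x + x′ ≤ y + y′ ≡if E
≡if-+ (x≤y , x≡y) (x′≤y′ , x′≡y′) = +-mono-≤ x≤y x′≤y′ , λ e → cong₂ _+_ (x≡y e) (x′≡y′ e)

≡if-weaken : ∀ {x y E E′} → (E′ → E) → x ≤ y ≡if E → x ≤ y ≡if E′
≡if-weaken E′⇒E (x≤y , x≡y) = x≤y , x≡y ∘ E′⇒E

≡if-pascal : ∀ {x y x′ y′ m k} → x ≤ y ≡if (m ≤ k) → x′ ≤ y′ ≡if (m ≤ suc k) →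
             x + x′ ≤ y + y′ ≡if (suc m ≤ suc k)
≡if-pascal b b′ = ≡if-+ (≡if-weaken s≤s⁻¹ b) (≡if-weaken (m≤n⇒m≤1+n ∘ s≤s⁻¹) b′)

-- choose≤ m e = Σ_{i ≤ e} C(m, i), the number of subsets of an m-set with at most e elements.
choose≤ : ℕ → ℕ → ℕ
choose≤ zero    _       = 1
choose≤ (suc m) zero    = 1
choose≤ (suc m) (suc e) = choose≤ m (suc e) + choose≤ m e

Σchoose≤ : ℕ → ℕ → ℕ
Σchoose≤ m zero    = 0
Σchoose≤ m (suc d) = Σchoose≤ m d + choose≤ m d

choose≤-zero : ∀ m → choose≤ m 0 ≡ 1
choose≤-zero zero = refl
choose≤-zero (suc m) = refl

choose≤-positive : ∀ m e → 1 ≤ choose≤ m e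
choose≤-positive zero e = ≤-refl
choose≤-positive (suc m) zero = ≤-refl
choose≤-positive (suc m) (suc e) = ≤-trans (choose≤-positive m (suc e)) (m≤m+n _ _)

choose≤-full : ∀ m e → m ≤ e → choose≤ m e ≡ 2 ^ m
choose≤-full zero e _ = refl
choose≤-full (suc m) (suc e) (s≤s m≤e) = begin
  choose≤ m (suc e) + choose≤ m e ≡⟨ cong₂ _+_ (choose≤-full m (suc e) (m≤n⇒m≤1+n m≤e))
                                                (choose≤-full m e m≤e) ⟩
  2 ^ m + 2 ^ m                   ≡⟨ cong (2 ^ m +_) (+-identityʳ (2 ^ m)) ⟨
  2 ^ suc m                       ∎
  where open ≡-Reasoning

Σchoose≤-pascal : ∀ m d → Σchoose≤ (suc m) (suc d) ≡ Σchoose≤ m (suc d) + Σchoose≤ m d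
Σchoose≤-pascal m zero = sym (trans (+-identityʳ _) (choose≤-zero m))
Σchoose≤-pascal m (suc d) = begin
  Σchoose≤ (suc m) (suc d) + (choose≤ m (suc d) + choose≤ m d)
    ≡⟨ cong (_+ (choose≤ m (suc d) + choose≤ m d)) (Σchoose≤-pascal m d) ⟩
  (Σchoose≤ m (suc d) + Σchoose≤ m d) + (choose≤ m (suc d) + choose≤ m d)
    ≡⟨ interchange (Σchoose≤ m (suc d)) _ _ _ ⟩
  Σchoose≤ m (suc (suc d)) + Σchoose≤ m (suc d) ∎
  where open ≡-Reasoning

Σchoose≤-diagonal : ∀ m → 2 * Σchoose≤ m m ≡ m * 2 ^ m
Σchoose≤-diagonal zero = refl
Σchoose≤-diagonal (suc m) = begin
  2 * Σchoose≤ (suc m) (suc m)                    ≡⟨ cong (2 *_) (Σchoose≤-pascal m m) ⟩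
  2 * (Σchoose≤ m m + choose≤ m m + Σchoose≤ m m) ≡⟨ cong (λ c → 2 * (Σchoose≤ m m + c + Σchoose≤ m m))
                                                          (choose≤-full m m ≤-refl) ⟩
  2 * (Σchoose≤ m m + 2 ^ m + Σchoose≤ m m)       ≡⟨ regroup (Σchoose≤ m m) (2 ^ m) ⟩
  2 * Σchoose≤ m m * 2 + 2 * 2 ^ m                ≡⟨ cong (λ x → x * 2 + 2 * 2 ^ m) (Σchoose≤-diagonal m) ⟩
  m * 2 ^ m * 2 + 2 * 2 ^ m                       ≡⟨ regroup′ m (2 ^ m) ⟩
  suc m * 2 ^ suc m                               ∎
  where
  open ≡-Reasoning
  regroup : ∀ s x → 2 * (s + x + s) ≡ 2 * s * 2 + 2 * x
  regroup = solve-∀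
  regroup′ : ∀ m x → m * x * 2 + 2 * x ≡ suc m * (2 * x)
  regroup′ = solve-∀

Σchoose≤-beyond : ∀ m t → Σchoose≤ m (m + t) ≡ Σchoose≤ m m + t * 2 ^ m
Σchoose≤-beyond m zero = trans (cong (Σchoose≤ m) (+-identityʳ m)) (sym (+-identityʳ _))
Σchoose≤-beyond m (suc t) = begin
  Σchoose≤ m (m + suc t)                  ≡⟨ cong (Σchoose≤ m) (+-suc m t) ⟩
  Σchoose≤ m (m + t) + choose≤ m (m + t)  ≡⟨ cong₂ _+_ (Σchoose≤-beyond m t)
                                                        (choose≤-full m (m + t) (m≤m+n m t)) ⟩
  Σchoose≤ m m + t * 2 ^ m + 2 ^ m        ≡⟨ +-assoc (Σchoose≤ m m) _ _ ⟩
  Σchoose≤ m m + (t * 2 ^ m + 2 ^ m)      ≡⟨ cong (Σchoose≤ m m +_) (+-comm (t * 2 ^ m) (2 ^ m)) ⟩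
  Σchoose≤ m m + suc t * 2 ^ m            ∎
  where open ≡-Reasoning

Σchoose≤-mono : ∀ m x d → Σchoose≤ m d ≤ Σchoose≤ m (x + d)
Σchoose≤-mono m zero d = ≤-refl
Σchoose≤-mono m (suc x) d = ≤-trans (Σchoose≤-mono m x d) (m≤m+n _ _)

2^[q+q]≡4^q : ∀ q → 2 ^ (q + q) ≡ 4 ^ q
2^[q+q]≡4^q q = sym (trans (^-*-assoc 2 2 q) (cong (λ z → 2 ^ (q + z)) (+-identityʳ q)))

Σchoose≤-even-diagonal : ∀ q → Σchoose≤ (q + q) (q + q) ≡ q * 4 ^ q
Σchoose≤-even-diagonal q = *-cancelˡ-≡ _ _ 2 (begin
  2 * Σchoose≤ (q + q) (q + q) ≡⟨ Σchoose≤-diagonal (q + q) ⟩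
  (q + q) * 2 ^ (q + q)        ≡⟨ cong ((q + q) *_) (2^[q+q]≡4^q q) ⟩
  (q + q) * 4 ^ q              ≡⟨ *-distribʳ-+ (4 ^ q) q q ⟩
  q * 4 ^ q + q * 4 ^ q        ≡⟨ cong (q * 4 ^ q +_) (+-identityʳ (q * 4 ^ q)) ⟨
  2 * (q * 4 ^ q)              ∎)
  where open ≡-Reasoning

Σchoose≤-even-beyond : ∀ q t → Σchoose≤ (q + q) (q + q + t) ≡ (q + t) * 4 ^ q
Σchoose≤-even-beyond q t = begin
  Σchoose≤ (q + q) (q + q + t)               ≡⟨ Σchoose≤-beyond (q + q) t ⟩
  Σchoose≤ (q + q) (q + q) + t * 2 ^ (q + q) ≡⟨ cong₂ (λ a b → a + t * b) (Σchoose≤-even-diagonal q)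
                                                                         (2^[q+q]≡4^q q) ⟩
  q * 4 ^ q + t * 4 ^ q                      ≡⟨ *-distribʳ-+ (4 ^ q) q t ⟨
  (q + t) * 4 ^ q                            ∎
  where open ≡-Reasoning

Σchoose≤-even-from : ∀ q h → q + q ≤ h → Σchoose≤ (q + q) (suc h) ≡ (suc h ∸ q) * 4 ^ q
Σchoose≤-even-from q h Q≤h with m≤n⇒∃[o]m+o≡n Q≤h
... | t , refl = begin
  Σchoose≤ (q + q) (suc (q + q + t))  ≡⟨ cong (Σchoose≤ (q + q)) (+-suc (q + q) t) ⟨
  Σchoose≤ (q + q) (q + q + suc t)    ≡⟨ Σchoose≤-even-beyond q (suc t) ⟩
  (q + suc t) * 4 ^ q                 ≡⟨ cong (_* 4 ^ q) (m+n∸m≡n q (q + suc t)) ⟨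
  (q + (q + suc t) ∸ q) * 4 ^ q       ≡⟨ cong (λ x → (x ∸ q) * 4 ^ q) (regroup q t) ⟩
  (suc (q + q + t) ∸ q) * 4 ^ q       ∎
  where
  open ≡-Reasoning
  regroup : ∀ q t → q + (q + suc t) ≡ suc (q + q + t)
  regroup = solve-∀

Σchoose≤-even-below : ∀ q h → h < q + q → Σchoose≤ (q + q) (suc h) ≤ q * 4 ^ q
Σchoose≤-even-below q h h<Q = ≤-trans (Σchoose≤-mono (q + q) (q + q ∸ suc h) (suc h))
  (≤-reflexive (trans (cong (Σchoose≤ (q + q)) (m∸n+n≡m h<Q)) (Σchoose≤-even-diagonal q)))

tailCount : ℕ → ℕ → ℕ → ℕ
tailCount j = accepted (just (tail j))

bodyCount : ℕ → ℕ → ℕ → ℕ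
bodyCount w = accepted (just (filled zero w))

tailCount-no-elems : ∀ j h → tailCount j h 0 ≡ 1
tailCount-no-elems j zero = refl
tailCount-no-elems zero (suc h) = tailCount-no-elems zero h
tailCount-no-elems (suc j) (suc h) = tailCount-no-elems j h

tailCount-zero : ∀ h k → tailCount 0 h (suc k) ≡ 0
tailCount-zero zero k = refl
tailCount-zero (suc h) k = tailCount-zero h k

bodyCount-no-holes : ∀ w k → bodyCount w 0 k ≡ 1
bodyCount-no-holes w zero = refl
bodyCount-no-holes w (suc k) = bodyCount-no-holes w k

bodyCount-zero : ∀ h k → bodyCount 0 h k ≡ 1
bodyCount-zero zero k = bodyCount-no-holes 0 k
bodyCount-zero (suc h) zero = tailCount-no-elems 0 h
bodyCount-zero (suc h) (suc k) = cong₂ _+_ (bodyCount-zero (suc h) k) (tailCount-zero h k)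

tailCount-one : ∀ w h → tailCount (suc w) h 1 ≡ bodyCount w h 1
tailCount-one w zero = refl
tailCount-one w (suc h) =
  cong (_+ tailCount w h 1) (trans (tailCount-no-elems w (suc h)) (sym (tailCount-no-elems w h)))

bodyCount-pascal : ∀ w h k →
  bodyCount (suc w) (suc h) (suc k) ≡ bodyCount w (suc h) k + bodyCount w h (suc k)
bodyCount-pascal w h zero =
  cong₂ _+_ (trans (tailCount-no-elems (suc w) h) (sym (tailCount-no-elems w h))) (tailCount-one w h)
bodyCount-pascal w h (suc k) = begin
  bodyCount (suc w) (suc h) (suc k) + tailCount (suc w) h (2 + k)
    ≡⟨ cong (_+ tailCount (suc w) h (2 + k)) (bodyCount-pascal w h k) ⟩
  bodyCount w (suc h) k + bodyCount w h (suc k) + tailCount (suc w) h (2 + k)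
    ≡⟨ +-assoc (bodyCount w (suc h) k) _ _ ⟩
  bodyCount w (suc h) k + (bodyCount w h (suc k) + tailCount (suc w) h (2 + k))
    ≡⟨ cong (bodyCount w (suc h) k +_) (exchange h) ⟩
  bodyCount w (suc h) k + (tailCount w h (suc k) + bodyCount w h (2 + k))
    ≡⟨ +-assoc (bodyCount w (suc h) k) _ _ ⟨
  bodyCount w (suc h) (suc k) + bodyCount w h (2 + k) ∎
  where
  open ≡-Reasoning
  exchange : ∀ h → bodyCount w h (suc k) + tailCount (suc w) h (2 + k)
                   ≡ tailCount w h (suc k) + bodyCount w h (2 + k)
  exchange zero rewrite bodyCount-no-holes w k = +-comm 1 _
  exchange (suc h) =
    x∙yz≈y∙xz (bodyCount w (suc h) (suc k)) (tailCount w (suc h) (suc k)) (tailCount w h (2 + k))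

bodyCount-bound : ∀ w h k → bodyCount w h k ≤ choose≤ w h ≡if (w ≤ k)
bodyCount-bound zero h k = ≡if-refl (bodyCount-zero h k)
bodyCount-bound (suc w) zero k = ≡if-refl (bodyCount-no-holes (suc w) k)
bodyCount-bound (suc w) (suc h) zero =
  ≤-trans (≤-reflexive (tailCount-no-elems (suc w) h)) (choose≤-positive (suc w) (suc h)) , λ ()
bodyCount-bound (suc w) (suc h) (suc k) rewrite bodyCount-pascal w h k =
  ≡if-pascal (bodyCount-bound w (suc h) k) (bodyCount-bound w h (suc k))

filledCount-bound : ∀ c w h k →
  accepted (just (filled c w)) h k ≤ choose≤ (c + w) h ≡if (c + w ≤ k)
filledCount-bound zero w h k = bodyCount-bound w h k
filledCount-bound (suc c) w zero zero = ≡if-refl refl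
filledCount-bound (suc c) w zero (suc k) with filledCount-bound c w zero k
... | x≤1 , x≡1 rewrite choose≤-zero (c + w) = x≤1 , x≡1 ∘ s≤s⁻¹
filledCount-bound (suc c) w (suc h) zero =
  ≤-trans (proj₁ (filledCount-bound c w h zero)) (m≤n+m _ _) , λ ()
filledCount-bound (suc c) w (suc h) (suc k) =
  ≡if-pascal (filledCount-bound c w (suc h) k) (filledCount-bound c w h (suc k))

startCount-bound : ∀ q h k →
  accepted (just (start q)) h (suc k) ≤ Σchoose≤ (q + q) (suc h) ≡if (q + q ≤ k)
startCount-bound q zero k = filledCount-bound q q zero k
startCount-bound q (suc h) k =
  subst (accepted (just (start q)) (suc h) (suc k) ≤_≡if (q + q ≤ k)) (+-comm _ (Σchoose≤ (q + q) (suc h)))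
    (≡if-+ (filledCount-bound q q (suc h) k) (startCount-bound q h k))

U-bound : ∀ q k h → U (suc q) (suc k + h) (suc k) ≤ Σchoose≤ (q + q) (suc h) ≡if (q + q ≤ k)
U-bound q k h = subst (_≤ Σchoose≤ (q + q) (suc h) ≡if (q + q ≤ k))
  (sym (U≡accepted q h (suc k) (+-comm h (suc k)))) (startCount-bound q h k)

2*[1+q]≡2+[q+q] : ∀ q → 2 * suc q ≡ 2 + (q + q)
2*[1+q]≡2+[q+q] = solve-∀

m+2∸2*[1+q]≡m∸[q+q] : ∀ m q → m + 2 ∸ 2 * suc q ≡ m ∸ (q + q)
m+2∸2*[1+q]≡m∸[q+q] m q =
  trans (cong₂ _∸_ (+-comm m 2) (2*[1+q]≡2+[q+q] q)) ([m+n]∸[m+o]≡n∸o 2 m (q + q))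

[1+k+h]+2∸[1+k]∸[1+q]≡1+h∸q : ∀ k h q → suc k + h + 2 ∸ suc k ∸ suc q ≡ suc h ∸ q
[1+k+h]+2∸[1+k]∸[1+q]≡1+h∸q k h q = cong (_∸ suc q) (begin
  suc k + h + 2 ∸ suc k   ≡⟨ cong (_∸ suc k) (+-assoc (suc k) h 2) ⟩
  suc k + (h + 2) ∸ suc k ≡⟨ m+n∸m≡n (suc k) (h + 2) ⟩
  h + 2                   ≡⟨ +-comm h 2 ⟩
  2 + h                   ∎)
  where open ≡-Reasoning

m≤n⇔1+k≤[1+k+n]∸m : ∀ k m n → m ≤ n ⇔ suc k ≤ suc k + n ∸ m
m≤n⇔1+k≤[1+k+n]∸m k m n = mk⇔
  (λ m≤n → ≤-trans (m≤m+n (suc k) (n ∸ m)) (≤-reflexive (sym (+-∸-assoc (suc k) m≤n))))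
  (λ 1+k≤ → ≮⇒≥ λ n<m → <⇒≱ (m<n+o⇒m∸n<o (suc k + n) m (1+k+n<m+[1+k] n<m)) 1+k≤)
  where
  1+k+n<m+[1+k] : n < m → suc k + n < m + suc k
  1+k+n<m+[1+k] n<m = subst (suc k + n <_) (+-comm (suc k) m) (+-monoʳ-< (suc k) n<m)

q+q≤h⇔1+k≤[1+k+h]+2∸2*[1+q] : ∀ q k h → q + q ≤ h ⇔ suc k ≤ suc k + h + 2 ∸ 2 * suc q
q+q≤h⇔1+k≤[1+k+h]+2∸2*[1+q] q k h = subst (λ x → q + q ≤ h ⇔ suc k ≤ x)
  (sym (m+2∸2*[1+q]≡m∸[q+q] (suc k + h) q)) (m≤n⇔1+k≤[1+k+n]∸m k (q + q) h)

2*[1+q]≤1+k⇒q+q≤k : ∀ q k → 2 * suc q ≤ suc k → q + q ≤ k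
2*[1+q]≤1+k⇒q+q≤k q k le = <⇒≤ (s≤s⁻¹ (subst (_≤ suc k) (2*[1+q]≡2+[q+q] q) le))

1+k<2*[1+q]⇒q+q≤h : ∀ q k h → suc k < 2 * suc q → 4 * suc q ∸ 2 ≤ suc k + h → q + q ≤ h
1+k<2*[1+q]⇒q+q≤h q k h K<2p 4p∸2≤n = <⇒≤ (+-cancelˡ-≤ (suc (q + q)) (suc (q + q)) h (begin
  suc (q + q) + suc (q + q) ≡⟨ trans (cong (_∸ 2) (4*[1+q]≡ q)) (m+n∸n≡m _ 2) ⟨
  4 * suc q ∸ 2             ≤⟨ 4p∸2≤n ⟩
  suc k + h                 ≤⟨ +-monoˡ-≤ h K≤1+Q ⟩
  suc (q + q) + h           ∎))
  where
  open ≤-Reasoning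
  4*[1+q]≡ : ∀ q → 4 * suc q ≡ suc (q + q) + suc (q + q) + 2
  4*[1+q]≡ = solve-∀
  K≤1+Q : suc k ≤ suc (q + q)
  K≤1+Q = s≤s⁻¹ (subst (suc (suc k) ≤_) (2*[1+q]≡2+[q+q] q) K<2p)

lemma4 : (p n k : ℕ) → 1 ≤ p → 1 ≤ n → 1 ≤ k → 4 * p ∸ 2 ≤ n → k > 1 →
    ((2 * p ≤ k × k ≤ n + 2 ∸ 2 * p) → U p n k ≡ (n + 2 ∸ k ∸ p) * 4 ^ (p ∸ 1))
    × (k < 2 * p → U p n k ≤ (n + 2 ∸ k ∸ p) * 4 ^ (p ∸ 1))
    × (k > n + 2 ∸ 2 * p → U p n k ≤ p * 4 ^ (p ∸ 1))
lemma4 zero _ _ () _ _ _ _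
lemma4 (suc q) _ zero _ _ () _ _
lemma4 (suc q) n (suc k) _ _ _ 4p∸2≤n _ with suc k ≤? n
... | no n≱K = (λ (_ , K≤) → contradiction (≤-trans K≤ n+2∸2p≤n) n≱K) , (λ _ → U≤) , (λ _ → U≤)
  where
  n+2∸2p≤n : n + 2 ∸ 2 * suc q ≤ n
  n+2∸2p≤n = ≤-trans (≤-reflexive (m+2∸2*[1+q]≡m∸[q+q] n q)) (m∸n≤m n (q + q))
  U≤ : ∀ {x} → U (suc q) n (suc k) ≤ x
  U≤ = ≤-trans (≤-reflexive (U-oversized (suc q) (≰⇒> n≱K))) z≤n
... | yes K≤n with m≤n⇒∃[o]m+o≡n K≤n
...   | h , refl =
    (λ (2p≤K , K≤) → trans (proj₂ bound (2*[1+q]≤1+k⇒q+q≤k q k 2p≤K)) (value (from Q≤h⇔ K≤)))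
  , (λ K<2p → ≤-trans (proj₁ bound) (≤-reflexive (value (1+k<2*[1+q]⇒q+q≤h q k h K<2p 4p∸2≤n))))
  , (λ K> → ≤-trans (proj₁ bound) (≤-trans (Σchoose≤-even-below q h (≰⇒> (<⇒≱ K> ∘ to Q≤h⇔)))
                                            (*-monoˡ-≤ (4 ^ q) (n≤1+n q))))
  where
  bound : U (suc q) (suc k + h) (suc k) ≤ Σchoose≤ (q + q) (suc h) ≡if (q + q ≤ k)
  bound = U-bound q k h
  value : q + q ≤ h → Σchoose≤ (q + q) (suc h) ≡ (suc k + h + 2 ∸ suc k ∸ suc q) * 4 ^ q
  value Q≤h = trans (Σchoose≤-even-from q h Q≤h) (cong (_* 4 ^ q) (sym ([1+k+h]+2∸[1+k]∸[1+q]≡1+h∸q k h q)))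
  Q≤h⇔ : q + q ≤ h ⇔ suc k ≤ suc k + h + 2 ∸ 2 * suc q
  Q≤h⇔ = q+q≤h⇔1+k≤[1+k+h]+2∸2*[1+q] q k h
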